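{- Fix $t\ge 1$ and suppose that, starting from the bounding state $y_0=((*,\dots,*,1),1)$ and applying $t$ sweeps with iid fair coins, the probability that the resulting bounding state contains no $*$ is at least $1/2$. Then the procedure CFTP$(t)$ uses on average at most $2t(n-1)$ fair random bits (i.e. at most $2t$ sweeps' worth of coins), and performs on average at most $3t$ sweeps.
   Context: Let $n\ge 2$, $\preceq$ a partial order on $[n]$ with the identity permutation a linear extension. Use the bounding states and the steps $A$ (adjacent transposition) and $B$ (bounding chain step) defined as follows. $A(\sigma,i,c)$: if $c=1$ and $\neg(\sigma(i)\preceq\sigma(i+1))$ swap positions $i,i+1$ of $\sigma$. A bounding state is $(r,k)$ with $k\in[n]$, $r\in(\{*\}\cup[n])^n$ with distinct numeric entries at most $k$. $B((r,k),i,c)$: if $c=1$ and not both $r(i),r(i+1)\in[n]$ with $r(i)\preceq r(i+1)$, exchange $r(i),r(i+1)$; then if $r(n)=*$ set $r(n)\leftarrow k+1$, $k\leftarrow k+1$. The simultaneous step $S(\sigma,y,i,c)=(A(\sigma,i,c'),B(y,i,c))$ where $c'=1-c$ if $\sigma(i)=r(i+1)$ and $c'=c$ otherwise. A sweep with coins $(c_1,\dots,c_{n-1})$ applies the step (bounding or simultaneous) successively at $i=1,\dots,n-1$ with coin $c_i$. Procedure CFTP$(t)$: draw $t$ independent vectors of $n-1$ fair bits; starting from $y_0=((*,\dots,*,1),1)$ apply $t$ bounding-chain sweeps with these coins; if the final $r$ contains no $*$, return it. Otherwise let $\sigma_0\leftarrow$ CFTP$(t)$ (a recursive, independent call), reset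 $y_0=((*,\dots,*,1),1)$, apply $t$ simultaneous sweeps with the same coins to $(\sigma_0,y_0)$, and return the final permutation. -}

module Defs where

open import Data.Nat using (ℕ; zero; suc; _+_; _*_; _^_; _<?_)
open import Data.Fin using (Fin; zero; suc; inject₁; fromℕ; fromℕ<)
open import Data.Bool using (Bool; true; false; not; _∧_; if_then_else_)
open import Data.Maybe using (Maybe; just; nothing; is-just; fromMaybe)
open import Data.Product using (_×_; _,_; proj₁; proj₂)
open import Data.List as L using (List; []; _∷_; length; filter; concatMap)
open import Data.Vec as V using (Vec; []; _∷_; lookup; _[_]≔_; replicate; allFin; zip; toList)
open import Level using (0ℓ)
open import Relation.Binary using (Rel; Decidable)
open import Relation.Binary.PropositionalEquality using (_≡_)
open import Relation.Nullary using (Dec; yes; no)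
open import Relation.Nullary.Decidable using (⌊_⌋)
import Data.Maybe.Properties as MP
import Data.Fin.Properties as FP

allBits : (k : ℕ) → List (Vec Bool k)
allBits zero = [] ∷ []
allBits (suc k) = concatMap (λ v → (false ∷ v) ∷ (true ∷ v) ∷ []) (allBits k)

allVecsOf : {A : Set} → List A → (k : ℕ) → List (Vec A k)
allVecsOf xs zero = [] ∷ []
allVecsOf xs (suc k) = concatMap (λ v → L.map (λ x → x ∷ v) xs) (allVecsOf xs k)

allListsOf : {A : Set} → List A → (q : ℕ) → List (List A)
allListsOf xs q = L.map V.toList (allVecsOf xs q)

sumL : List ℕ → ℕ
sumL = L.foldr _+_ 0

-- Conventions: n = suc m (so n-1 = m).  Elements of [n] are Fin n, where the
-- paper's element j corresponds to index j-1.  Positions 1..n are Fin n as well;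
-- the step index i ∈ {1..n-1} is Fin m, acting on positions inject₁ i and suc i.
module CFTP {m : ℕ} (_≼_ : Rel (Fin (suc m)) 0ℓ) (_≼?_ : Decidable _≼_) (t : ℕ) where

  n : ℕ
  n = suc m

  Perm : Set
  Perm = Vec (Fin n) n

  swapAt : {A : Set} → Fin m → Vec A n → Vec A n
  swapAt i v = (v [ inject₁ i ]≔ lookup v (suc i)) [ suc i ]≔ lookup v (inject₁ i)

  stepA : Perm → Fin m → Bool → Perm
  stepA σ i c =
    if c ∧ not ⌊ lookup σ (inject₁ i) ≼? lookup σ (suc i) ⌋ then swapAt i σ else σ

  -- bounding states: r with entries * (= nothing) or numbers, and k
  BState : Set
  BState = Vec (Maybe (Fin n)) n × ℕ

  bothLe : Maybe (Fin n) → Maybe (Fin n) → Bool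
  bothLe (just a) (just b) = ⌊ a ≼? b ⌋
  bothLe _ _ = false

  -- the paper's element k+1, i.e. index k (only used when k < n, which always
  -- holds when some * is present)
  elemSuc : ℕ → Maybe (Fin n)
  elemSuc k with k <? n
  ... | yes p = just (fromℕ< p)
  ... | no _ = nothing

  stepB : BState → Fin m → Bool → BState
  stepB (r , k) i c with (if c ∧ not (bothLe (lookup r (inject₁ i)) (lookup r (suc i))) then swapAt i r else r)
  ... | r' with lookup r' (fromℕ m)
  ...   | nothing = (r' [ fromℕ m ]≔ elemSuc k) , suc k
  ...   | just _ = r' , k

  stepS : Perm × BState → Fin m → Bool → Perm × BState
  stepS (σ , (r , k)) i c =
    stepA σ i c' , stepB (r , k) i c
    where
      c' : Bool
      c' = if ⌊ MP.≡-dec FP._≟_ (lookup r (suc i)) (just (lookup σ (inject₁ i))) ⌋ then not c else c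

  sweep : {S : Set} → (S → Fin m → Bool → S) → S → Vec Bool m → S
  sweep f s cs = L.foldl (λ s ic → f s (proj₁ ic) (proj₂ ic)) s (toList (zip (allFin m) cs))

  Coins : Set
  Coins = Vec (Vec Bool m) t

  sweeps : {S : Set} → (S → Fin m → Bool → S) → S → Coins → S
  sweeps f s cs = L.foldl (sweep f) s (toList cs)

  y₀ : BState
  y₀ = (replicate n nothing [ fromℕ m ]≔ just zero) , 1

  noStar : Vec (Maybe (Fin n)) n → Bool
  noStar r = L.foldr (λ x b → is-just x ∧ b) true (toList r)

  toPerm : Vec (Maybe (Fin n)) n → Perm
  toPerm = V.map (fromMaybe zero)

  success : Coins → Bool
  success c = noStar (proj₁ (sweeps stepB y₀ c))

  -- the uniform sample space of coin blocks (t vectors of n-1 fair bits)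
  allCoins : List Coins
  allCoins = allVecsOf (allBits m) t

  -- Outcome of running CFTP(t) on a finite prefix of the random source,
  -- cut into consecutive blocks of t(n-1) bits (one block per (recursive) call).
  --   done σ ℓ s : the procedure returned σ, having made ℓ calls
  --                (hence used ℓ·t(n-1) bits) and performed s sweeps;
  --   blocked s  : the prefix ran out; s sweeps were performed before that.
  data Outcome : Set where
    done    : Perm → ℕ → ℕ → Outcome
    blocked : ℕ → Outcome

  run : List Coins → Outcome
  run [] = blocked 0
  run (c ∷ cs) with success c
  ... | true = done (toPerm (proj₁ (sweeps stepB y₀ c))) 1 t
  ... | false with run cs
  ...   | done σ₀ ℓ s = done (proj₁ (sweeps stepS (σ₀ , y₀) c)) (suc ℓ) (t + s + t)
  ...   | blocked s = blocked (t + s)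

  -- number of random bits consumed, truncated at the prefix length q·t(n-1)
  -- (i.e. min(bits used, q·t(n-1)))
  bitsTrunc : ℕ → List Coins → ℕ
  bitsTrunc q cs with run cs
  ... | done _ ℓ _ = ℓ * (t * m)
  ... | blocked _ = q * (t * m)

  sweepsTrunc : List Coins → ℕ
  sweepsTrunc cs with run cs
  ... | done _ _ s = s
  ... | blocked s = s

{-# OPTIONS --safe #-}
module Submission where

open import Defs
open import Data.Nat using (ℕ; zero; suc; _+_; _*_; _^_; _≤_; z≤n)
open import Data.Nat.Properties
open import Data.Nat.ListAction.Properties using (sum-++)
open import Data.Nat.Tactic.RingSolver using (solve-∀)
open import Data.Fin using (Fin; toℕ)
open import Data.List using (List; []; _∷_; _++_; length; filter; map; concatMap)
open import Data.List.Properties using (length-++; length-map; map-++; map-∘; map-cong; map-concatMap; concatMap-cong; concatMap-map)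
open import Data.Vec as V using (toList)
open import Data.Bool using (Bool; true; false; not; if_then_else_)
open import Relation.Nullary.Decidable using (T?)
open import Data.Product using (_×_; _,_)
open import Function using (_∘_)
open import Level using (0ℓ)
open import Relation.Binary using (Rel; Decidable; IsPartialOrder)
open import Relation.Binary.PropositionalEquality using (_≡_; refl; sym; trans; cong; cong₂; subst; module ≡-Reasoning)

-- CFTP(t) reads the random source in blocks of t sweeps' coins, one block per call, and recurses
-- exactly when its block fails, which happens for at most half of the blocks.  If a call costs a,
-- plus c and the cost of the recursive call when its block fails, the expected cost E satisfies
-- E ≤ a + (c + E)/2, i.e. E ≤ 2a + c.  For random bits a = t(n-1) and c = 0; for sweeps a = t and
-- c = t (the simultaneous sweeps after the recursive call).  Averaging over the first q blocks
-- makes this an inequality between finite sums, proved by induction on q.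

private variable
  A B : Set

length-concatMap : (k : ℕ) (g : A → List B) → (∀ x → length (g x) ≡ k) →
                   ∀ xs → length (concatMap g xs) ≡ length xs * k
length-concatMap k g len [] = refl
length-concatMap k g len (x ∷ xs) =
  trans (length-++ (g x)) (cong₂ _+_ (len x) (length-concatMap k g len xs))

sumL-map-concatMap : (f : B → ℕ) (g : A → List B) →
                     ∀ xs → sumL (map f (concatMap g xs)) ≡ sumL (map (sumL ∘ map f ∘ g) xs)
sumL-map-concatMap f g [] = refl
sumL-map-concatMap f g (x ∷ xs) = begin
  sumL (map f (g x ++ concatMap g xs))                ≡⟨ cong sumL (map-++ f (g x) _) ⟩
  sumL (map f (g x) ++ map f (concatMap g xs))        ≡⟨ sum-++ (map f (g x)) _ ⟩
  sumL (map f (g x)) + sumL (map f (concatMap g xs))  ≡⟨ cong (sumL (map f (g x)) +_) (sumL-map-concatMap f g xs) ⟩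
  sumL (map f (g x)) + sumL (map (sumL ∘ map f ∘ g) xs) ∎
  where open ≡-Reasoning

sumL-map-mono : {f g : A → ℕ} → (∀ x → f x ≤ g x) → ∀ xs → sumL (map f xs) ≤ sumL (map g xs)
sumL-map-mono f≤g [] = z≤n
sumL-map-mono f≤g (x ∷ xs) = +-mono-≤ (f≤g x) (sumL-map-mono f≤g xs)

sumL-map-affine : (c d : ℕ) (h : A → ℕ) →
                  ∀ xs → sumL (map (λ x → c + d * h x) xs) ≡ length xs * c + d * sumL (map h xs)
sumL-map-affine c d h [] = sym (*-zeroʳ d)
sumL-map-affine c d h (x ∷ xs) rewrite sumL-map-affine c d h xs =
  regroup c d (h x) (length xs) (sumL (map h xs))
  where
  regroup : ∀ c d y l s → c + d * y + (l * c + d * s) ≡ c + l * c + d * (y + s)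
  regroup = solve-∀

length-allVecsOf : (xs : List A) → ∀ k → length (allVecsOf xs k) ≡ length xs ^ k
length-allVecsOf xs zero = refl
length-allVecsOf xs (suc k) = begin
  length (allVecsOf xs (suc k))        ≡⟨ length-concatMap (length xs) _ (λ v → length-map _ xs) (allVecsOf xs k) ⟩
  length (allVecsOf xs k) * length xs  ≡⟨ cong (_* length xs) (length-allVecsOf xs k) ⟩
  length xs ^ k * length xs            ≡⟨ *-comm (length xs ^ k) (length xs) ⟩
  length xs ^ suc k                    ∎
  where open ≡-Reasoning

length-allListsOf : (xs : List A) → ∀ q → length (allListsOf xs q) ≡ length xs ^ q
length-allListsOf xs q = trans (length-map toList (allVecsOf xs q)) (length-allVecsOf xs q)

allListsOf-suc : (xs : List A) → ∀ q →
                 allListsOf xs (suc q) ≡ concatMap (λ ys → map (_∷ ys) xs) (allListsOf xs q)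
allListsOf-suc xs q = begin
  map toList (concatMap (λ v → map (V._∷ v) xs) (allVecsOf xs q))
    ≡⟨ map-concatMap toList _ (allVecsOf xs q) ⟩
  concatMap (λ v → map toList (map (V._∷ v) xs)) (allVecsOf xs q)
    ≡⟨ concatMap-cong (λ v → sym (map-∘ xs)) (allVecsOf xs q) ⟩
  concatMap (λ v → map (_∷ toList v) xs) (allVecsOf xs q)
    ≡⟨ sym (concatMap-map (λ ys → map (_∷ ys) xs) toList (allVecsOf xs q)) ⟩
  concatMap (λ ys → map (_∷ ys) xs) (allListsOf xs q)
    ∎
  where open ≡-Reasoning

successes failures : (A → Bool) → List A → ℕ
successes p = length ∘ filter (T? ∘ p)
failures p = length ∘ filter (T? ∘ not ∘ p)

successes+failures : (p : A → Bool) → ∀ xs → successes p xs + failures p xs ≡ length xs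
successes+failures p [] = refl
successes+failures p (x ∷ xs) with p x
... | true = cong suc (successes+failures p xs)
... | false = trans (+-suc _ _) (cong suc (successes+failures p xs))

failures-≤-half : (p : A → Bool) → ∀ xs → length xs ≤ 2 * successes p xs → 2 * failures p xs ≤ length xs
failures-≤-half p xs half = +-cancelʳ-≤ (length xs) (2 * F) (length xs) (begin
  2 * F + length xs   ≤⟨ +-monoʳ-≤ (2 * F) half ⟩
  2 * F + 2 * S       ≡⟨ sym (*-distribˡ-+ 2 F S) ⟩
  2 * (F + S)         ≡⟨ cong (2 *_) (trans (+-comm F S) (successes+failures p xs)) ⟩
  2 * length xs       ≡⟨ cong (length xs +_) (+-identityʳ (length xs)) ⟩
  length xs + length xs ∎)
  where
  open ≤-Reasoning
  S = successes p xs
  F = failures p xs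

sumL-map-≤-failures : (p : A → Bool) {f : A → ℕ} (a b : ℕ) → (∀ x → f x ≤ (if p x then a else a + b)) →
                ∀ xs → sumL (map f xs) ≤ length xs * a + failures p xs * b
sumL-map-≤-failures p a b f≤ [] = z≤n
sumL-map-≤-failures p {f} a b f≤ (x ∷ xs) with p x | f≤ x
... | true | fx≤ = subst (f x + sumL (map f xs) ≤_) (sym (+-assoc a _ _)) (+-mono-≤ fx≤ (sumL-map-≤-failures p a b f≤ xs))
... | false | fx≤ = subst (f x + sumL (map f xs) ≤_) (regroup a b (length xs * a) (failures p xs * b))
                           (+-mono-≤ fx≤ (sumL-map-≤-failures p a b f≤ xs))
  where
  regroup : ∀ a b u v → a + b + (u + v) ≡ a + u + (b + v)
  regroup = solve-∀

-- g q ys: cost of a run reading the prefix ys of q blocks, truncated when the prefix runs out.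
RestartCost : (A → Bool) → ℕ → ℕ → (ℕ → List A → ℕ) → Set
RestartCost p a c g = ∀ q x ys → g (suc q) (x ∷ ys) ≤ (if p x then a else a + (c + g q ys))

restart-step-≤ : ∀ N F a c M → 2 * F ≤ N →
                M * (N * a + F * c) + F * ((2 * a + c) * M) ≤ (2 * a + c) * (N * M)
restart-step-≤ N F a c M 2F≤N = begin
  M * (N * a + F * c) + F * ((2 * a + c) * M) ≡⟨ regroupˡ M N F a c ⟩
  M * (N * a + 2 * F * (a + c))               ≤⟨ *-monoʳ-≤ M (+-monoʳ-≤ (N * a) (*-monoˡ-≤ (a + c) 2F≤N)) ⟩
  M * (N * a + N * (a + c))                   ≡⟨ regroupʳ M N a c ⟩
  (2 * a + c) * (N * M)                       ∎
  where
  open ≤-Reasoning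
  regroupˡ : ∀ M N F a c → M * (N * a + F * c) + F * ((2 * a + c) * M) ≡ M * (N * a + 2 * F * (a + c))
  regroupˡ = solve-∀
  regroupʳ : ∀ M N a c → M * (N * a + N * (a + c)) ≡ (2 * a + c) * (N * M)
  regroupʳ = solve-∀

sumL-allListsOf-≤ : (xs : List A) (p : A → Bool) {a c : ℕ} {g : ℕ → List A → ℕ} →
                    length xs ≤ 2 * successes p xs → RestartCost p a c g → g 0 [] ≡ 0 →
                    ∀ q → sumL (map (g q) (allListsOf xs q)) ≤ (2 * a + c) * length xs ^ q
sumL-allListsOf-≤ xs p {a} {c} {g} half restart g0 = bound
  where
  N = length xs
  F = failures p xs
  E : ℕ → ℕ
  E q = sumL (map (g q) (allListsOf xs q))

  bound : ∀ q → E q ≤ (2 * a + c) * N ^ q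
  bound zero rewrite g0 = z≤n
  bound (suc q) = begin
    E (suc q)
      ≡⟨ cong (sumL ∘ map (g (suc q))) (allListsOf-suc xs q) ⟩
    sumL (map (g (suc q)) (concatMap (λ ys → map (_∷ ys) xs) (allListsOf xs q)))
      ≡⟨ sumL-map-concatMap (g (suc q)) _ (allListsOf xs q) ⟩
    sumL (map (λ ys → sumL (map (g (suc q)) (map (_∷ ys) xs))) (allListsOf xs q))
      ≡⟨ cong sumL (map-cong (λ ys → cong sumL (sym (map-∘ xs))) (allListsOf xs q)) ⟩
    sumL (map (λ ys → sumL (map (λ x → g (suc q) (x ∷ ys)) xs)) (allListsOf xs q))
      ≤⟨ sumL-map-mono (λ ys → sumL-map-≤-failures p a (c + g q ys) (λ x → restart q x ys) xs) (allListsOf xs q) ⟩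
    sumL (map (λ ys → N * a + F * (c + g q ys)) (allListsOf xs q))
      ≡⟨ cong sumL (map-cong (λ ys → distrib (N * a) F c (g q ys)) (allListsOf xs q)) ⟩
    sumL (map (λ ys → (N * a + F * c) + F * g q ys) (allListsOf xs q))
      ≡⟨ sumL-map-affine (N * a + F * c) F (g q) (allListsOf xs q) ⟩
    length (allListsOf xs q) * (N * a + F * c) + F * E q
      ≡⟨ cong (λ l → l * (N * a + F * c) + F * E q) (length-allListsOf xs q) ⟩
    N ^ q * (N * a + F * c) + F * E q
      ≤⟨ +-monoʳ-≤ (N ^ q * (N * a + F * c)) (*-monoʳ-≤ F (bound q)) ⟩
    N ^ q * (N * a + F * c) + F * ((2 * a + c) * N ^ q)
      ≤⟨ restart-step-≤ N F a c (N ^ q) (failures-≤-half p xs half) ⟩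
    (2 * a + c) * N ^ suc q
      ∎
    where
    open ≤-Reasoning
    distrib : ∀ u F c y → u + F * (c + y) ≡ u + F * c + F * y
    distrib = solve-∀

length-allBits : ∀ k → length (allBits k) ≡ 2 ^ k
length-allBits zero = refl
length-allBits (suc k) = trans (length-concatMap 2 _ (λ _ → refl) (allBits k))
                               (trans (cong (_* 2) (length-allBits k)) (*-comm (2 ^ k) 2))

module _ {m : ℕ} (_≼_ : Rel (Fin (suc m)) 0ℓ) (_≼?_ : Decidable _≼_) (t : ℕ) where
  open CFTP _≼_ _≼?_ t

  length-allCoins : length allCoins ≡ 2 ^ (t * m)
  length-allCoins = begin
    length (allVecsOf (allBits m) t)  ≡⟨ length-allVecsOf (allBits m) t ⟩
    length (allBits m) ^ t            ≡⟨ cong (_^ t) (length-allBits m) ⟩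
    (2 ^ m) ^ t                       ≡⟨ ^-*-assoc 2 m t ⟩
    2 ^ (m * t)                       ≡⟨ cong (2 ^_) (*-comm m t) ⟩
    2 ^ (t * m)                       ∎
    where open ≡-Reasoning

  bitsTrunc-restart : RestartCost success (t * m) 0 bitsTrunc
  bitsTrunc-restart q x ys with success x
  ... | true = ≤-reflexive (+-identityʳ (t * m))
  ... | false with run ys
  ...   | done _ _ _ = ≤-refl
  ...   | blocked _ = ≤-refl

  sweepsTrunc-restart : RestartCost success t t (λ _ → sweepsTrunc)
  sweepsTrunc-restart _ x ys with success x
  ... | true = ≤-refl
  ... | false with run ys
  ...   | done _ _ s = ≤-reflexive (trans (+-assoc t s t) (cong (t +_) (+-comm s t)))
  ...   | blocked s = +-monoʳ-≤ t (m≤n+m s t)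

-- Only the way CFTP(t) consumes blocks matters, so the hypotheses on n, t and the order are unused.
lemma3 : (m : ℕ) → 1 ≤ m
    → (_≼_ : Rel (Fin (suc m)) 0ℓ) → (_≼?_ : Decidable _≼_)
    → IsPartialOrder _≡_ _≼_
    → (∀ a b → a ≼ b → toℕ a ≤ toℕ b)
    → (t : ℕ) → 1 ≤ t
    → 2 ^ (t * m) ≤ 2 * length (filter (λ c → T? (CFTP.success _≼_ _≼?_ t c)) (CFTP.allCoins _≼_ _≼?_ t))
    → ∀ q →
        (sumL (map (CFTP.bitsTrunc _≼_ _≼?_ t q) (allListsOf (CFTP.allCoins _≼_ _≼?_ t) q))
          ≤ 2 * (t * m) * (2 ^ (t * m)) ^ q)
      ×
        (sumL (map (CFTP.sweepsTrunc _≼_ _≼?_ t) (allListsOf (CFTP.allCoins _≼_ _≼?_ t) q))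
          ≤ 3 * t * (2 ^ (t * m)) ^ q)
lemma3 m _ _≼_ _≼?_ _ _ t _ half q = bits-bound , sweeps-bound
  where
  open CFTP _≼_ _≼?_ t
  open ≤-Reasoning
  N≡ : length allCoins ≡ 2 ^ (t * m)
  N≡ = length-allCoins _≼_ _≼?_ t
  half′ : length allCoins ≤ 2 * successes success allCoins
  half′ = subst (_≤ 2 * successes success allCoins) (sym N≡) half
  bits-bound : sumL (map (bitsTrunc q) (allListsOf allCoins q)) ≤ 2 * (t * m) * (2 ^ (t * m)) ^ q
  bits-bound = begin
    sumL (map (bitsTrunc q) (allListsOf allCoins q))
      ≤⟨ sumL-allListsOf-≤ allCoins success half′ (bitsTrunc-restart _≼_ _≼?_ t) refl q ⟩
    (2 * (t * m) + 0) * length allCoins ^ q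
      ≡⟨ cong₂ (λ k N → k * N ^ q) (+-identityʳ (2 * (t * m))) N≡ ⟩
    2 * (t * m) * (2 ^ (t * m)) ^ q ∎
  sweeps-bound : sumL (map sweepsTrunc (allListsOf allCoins q)) ≤ 3 * t * (2 ^ (t * m)) ^ q
  sweeps-bound = begin
    sumL (map sweepsTrunc (allListsOf allCoins q))
      ≤⟨ sumL-allListsOf-≤ allCoins success half′ (sweepsTrunc-restart _≼_ _≼?_ t) refl q ⟩
    (2 * t + t) * length allCoins ^ q
      ≡⟨ cong₂ (λ k N → k * N ^ q) (+-comm (2 * t) t) N≡ ⟩
    3 * t * (2 ^ (t * m)) ^ q ∎
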